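{- During the run of the Quadratic Decay algorithm on any day, if thread $i$ subsumes thread $j$, then $d(S_i,S_j)\le \mathrm{radius}(i)-\mathrm{radius}(j)$.
   Context: Setting: $\mathbf{S}$ is a metric space with metric $d$; on day $t$ an instance $I_t$ with unknown solution $S_t$ arrives and the solutions $S_{t'}$ of earlier days are known. A warm start algorithm $\mathcal{A}(I_t,P)$ finds $S_t$ after at most $d(S_t,P)$ steps. Quadratic Decay algorithm, on day $t$: create one thread per earlier solution, thread $t'$ running $\mathcal{A}(I_t,S_{t'})$, placed in a linked list of active threads ordered from most recent $t'$ to oldest. Active threads are run interleaved so that the $i$-th thread in the current list runs at rate $\frac{1}{i^2\ln^2 i}$ (rate $1$ for $i=1$), i.e., takes that many steps per step of the first thread. $\mathrm{radius}(t')$ is the number of steps thread $t'$ has taken. After each step of a thread $t_1$, for every active thread $t_2$ with faster rate (earlier in the list), if $d(S_{t_1},S_{t_2})\le \mathrm{radius}(t_2)-\mathrm{radius}(t_1)$, thread $t_1$ is killed and removed from the list (so later threads move up to faster rates). The day ends when some thread completes (finds $S_t$). Definitions: if thread $i$ kills thread $j$, then $i$ subsumes $j$; if $j$ previously subsumed $h$, then $i$ now also subsumes $h$. For analysis, once $j$ is subsumed by $i$, $\mathrm{rate}(j)$ is set equal to $\mathrm{rate}(i)$ and $\mathrm{radius}(j)$ keeps increasing at that rate.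
   Formalization: The metric d on the solution space $\mathbf{S}$ takes values in the rationals. -}

module Defs where

open import Data.Nat using (ℕ; suc)
open import Data.Integer using (+_)
open import Data.Rational using (ℚ; 0ℚ; _/_; _≤_; _-_; _+_)
open import Data.Bool using (Bool; true; false; if_then_else_; _∨_; _∧_)
open import Data.Fin using (Fin; _≟_)
open import Data.List using (List; []; _∷_; reverse; filter)
open import Data.List.Base using (allFin)
open import Data.List.Membership.Propositional using (_∈_)
open import Data.Product using (Σ; _×_; _,_)
open import Relation.Nullary using (¬_; ¬?)
open import Relation.Nullary.Decidable using (⌊_⌋)
open import Relation.Binary.PropositionalEquality using (_≡_)

record MetricSpace : Set₁ where
  field
    Carrier   : Set
    d         : Carrier → Carrier → ℚ
    d-nonneg  : ∀ x y → 0ℚ ≤ d x y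
    d-zero    : ∀ x y → d x y ≡ 0ℚ → x ≡ y
    d-self    : ∀ x → d x x ≡ 0ℚ
    d-sym     : ∀ x y → d x y ≡ d y x
    d-triangle : ∀ x y z → d x z ≤ d x y + d y z

⟦_⟧ : ℕ → ℚ
⟦ n ⟧ = + n / 1

data Before {A : Set} (a b : A) : List A → Set where
  here  : ∀ {xs} → b ∈ xs → Before a b (a ∷ xs)
  there : ∀ {x xs} → Before a b xs → Before a b (x ∷ xs)

-- Quadratic Decay, day t.  Threads are indexed by the earlier days
-- t' : Fin t; thread t' runs A(I_t, S_t').

module QuadraticDecay (M : MetricSpace) {t : ℕ} (S : Fin t → MetricSpace.Carrier M) where
  open MetricSpace M

  record State : Set where
    field
      active : List (Fin t)              -- linked list of active threads (fastest first)
      radius : Fin t → ℕ                 -- radius(t') (continued for subsumed threads, see Context)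
      subs   : Fin t → Fin t → Bool
  open State public

  initial : State
  initial = record
    { active = reverse (allFin t)
    ; radius = λ _ → 0
    ; subs   = λ _ _ → false
    }

  -- one step of the active thread k: k's radius grows by one step, and so
  -- does the radius of every thread subsumed by k (their rate equals rate(k))
  advance : Fin t → State → State
  advance k s = record
    { active = active s
    ; radius = λ x → if ⌊ x ≟ k ⌋ ∨ subs s k x then suc (radius s x) else radius s x
    ; subs   = subs s
    }

  KillCond : State → Fin t → Fin t → Set
  KillCond s k t2 = d (S k) (S t2) ≤ (⟦ radius s t2 ⟧ - ⟦ radius s k ⟧)

  kill : Fin t → Fin t → State → State
  kill t2 k s = record
    { active = filter (λ x → ¬? (x ≟ k)) (active s)
    ; radius = radius s
    ; subs   = λ i j → subs s i j ∨ (⌊ i ≟ t2 ⌋ ∧ (⌊ j ≟ k ⌋ ∨ subs s k j))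
    }

  -- one step of the algorithm (the interleaving scheduler is arbitrary)
  data Step : State → State → Set where
    step-kill   : ∀ {s} k t2 → k ∈ active s →
                  Before t2 k (active (advance k s)) →
                  KillCond (advance k s) k t2 →
                  Step s (kill t2 k (advance k s))
    step-nokill : ∀ {s} k → k ∈ active s →
                  (∀ t2 → Before t2 k (active (advance k s)) → ¬ KillCond (advance k s) k t2) →
                  Step s (advance k s)

  data Reachable : State → Set where
    start : Reachable initial
    next  : ∀ {s s'} → Reachable s → Step s s' → Reachable s'

  Subsumes : State → Fin t → Fin t → Set
  Subsumes s i j = subs s i j ≡ true

{-# OPTIONS --safe #-}
-- Three facts about the reachable states are preserved together by every step:
-- a subsumed thread is inactive, any two subsumers of a common thread are
-- comparable, and a subsumer i of j satisfies d(S_i,S_j) ≤ radius(i) - radius(j).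
-- A step of the active thread k raises the radius of k and of everything k
-- subsumes; a subsumer of such a thread is itself k or subsumed by k (k is
-- active, so comparability leaves no other choice), hence the radius of a
-- subsumer never falls behind that of its subsumee.  A kill of k by t2 adds
-- the pairs (t2,k), bounded by the kill test, and (t2,j) for j subsumed by k,
-- bounded by the triangle inequality through S_k, the radius differences
-- telescoping.
module Submission where

open import Defs
open import Data.Nat using (ℕ; suc)
open import Data.Integer as ℤ using (+_)
import Data.Integer.Properties as ℤ
import Data.Nat.Coprimality as Coprime
open import Data.Fin using (Fin; _≟_)
open import Data.Rational using (mkℚ; 0ℚ; 1ℚ; _≤_; _-_; _+_; _/_)
open import Data.Rational.Properties
  using (normalize-coprime; +-identityˡ; ≤-trans; +-mono-≤; +-monoˡ-≤; nonNegative⁻¹; module ≤-Reasoning)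
open import Data.Rational.Solver using (module +-*-Solver)
open import Data.Bool using (true; false; _∨_; _∧_)
open import Data.List.Membership.Propositional using (_∈_; _∉_)
open import Data.List.Membership.Propositional.Properties using (∈-filter⁻)
open import Data.Product using (_×_; _,_)
open import Data.Sum using (_⊎_; inj₁; inj₂) renaming (map to ⊎-map)
open import Data.Sum.Function.Propositional using (_⊎-⇔_)
open import Data.Product.Function.NonDependent.Propositional using (_×-⇔_)
open import Function using (_⇔_; mk⇔; Equivalence; _∘_; const; case_of_)
open import Function.Construct.Composition using (_⇔-∘_)
open import Function.Construct.Identity using (⇔-id)
open import Relation.Nullary using (Dec; yes; no; ¬_; ¬?; contradiction)
open import Relation.Nullary.Decidable using (⌊_⌋)
open import Relation.Binary.PropositionalEquality using (_≡_; _≢_; refl; sym; trans; cong; cong₂; subst; module ≡-Reasoning)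

open Equivalence using (to; from)

∨≡true⇔ : ∀ {x y} → x ∨ y ≡ true ⇔ (x ≡ true ⊎ y ≡ true)
∨≡true⇔ {true}  = mk⇔ inj₁ (const refl)
∨≡true⇔ {false} = mk⇔ inj₂ λ { (inj₁ ()) ; (inj₂ y≡true) → y≡true }

∧≡true⇔ : ∀ {x y} → x ∧ y ≡ true ⇔ (x ≡ true × y ≡ true)
∧≡true⇔ {true}  = mk⇔ (refl ,_) λ { (_ , y≡true) → y≡true }
∧≡true⇔ {false} = mk⇔ (λ ()) λ { (() , _) }

⌊⌋≡true⇔ : ∀ {A : Set} (a? : Dec A) → ⌊ a? ⌋ ≡ true ⇔ A
⌊⌋≡true⇔ (yes a) = mk⇔ (const a) (const refl)
⌊⌋≡true⇔ (no ¬a) = mk⇔ (λ ()) (λ a → contradiction a ¬a)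

⟦⟧≡mkℚ : ∀ n → ⟦ n ⟧ ≡ mkℚ (+ n) 0 (Coprime.sym (Coprime.1-coprimeTo n))
⟦⟧≡mkℚ n = normalize-coprime (Coprime.sym (Coprime.1-coprimeTo n))

⟦suc⟧ : ∀ n → ⟦ suc n ⟧ ≡ 1ℚ + ⟦ n ⟧
⟦suc⟧ n = begin
  ⟦ suc n ⟧                  ≡⟨⟩
  (+ 1 ℤ.+ + n) / 1          ≡⟨ cong (λ z → (+ 1 ℤ.+ z) / 1) (ℤ.*-identityʳ (+ n)) ⟨
  -- the sum of two fractions reduces once ⟦ n ⟧ is in normal form
  (+ 1 ℤ.+ + n ℤ.* + 1) / 1  ≡⟨ cong (_+_ 1ℚ) (⟦⟧≡mkℚ n) ⟨
  1ℚ + ⟦ n ⟧                 ∎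
  where open ≡-Reasoning

module _ where
  open +-*-Solver

  1+p-1+q≡p-q : ∀ p q → (1ℚ + p) - (1ℚ + q) ≡ p - q
  1+p-1+q≡p-q = solve 2 (λ p q → (con 1ℚ :+ p) :- (con 1ℚ :+ q) := p :- q) refl

  1+p-q≡1+[p-q] : ∀ p q → (1ℚ + p) - q ≡ 1ℚ + (p - q)
  1+p-q≡1+[p-q] = solve 2 (λ p q → (con 1ℚ :+ p) :- q := con 1ℚ :+ (p :- q)) refl

  p-q+q-r≡p-r : ∀ p q r → (p - q) + (q - r) ≡ p - r
  p-q+q-r≡p-r = solve 3 (λ p q r → (p :- q) :+ (q :- r) := p :- r) refl

⟦suc⟧-⟦suc⟧ : ∀ m n → ⟦ suc m ⟧ - ⟦ suc n ⟧ ≡ ⟦ m ⟧ - ⟦ n ⟧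
⟦suc⟧-⟦suc⟧ m n = begin
  ⟦ suc m ⟧ - ⟦ suc n ⟧        ≡⟨ cong₂ _-_ (⟦suc⟧ m) (⟦suc⟧ n) ⟩
  (1ℚ + ⟦ m ⟧) - (1ℚ + ⟦ n ⟧)  ≡⟨ 1+p-1+q≡p-q ⟦ m ⟧ ⟦ n ⟧ ⟩
  ⟦ m ⟧ - ⟦ n ⟧                ∎
  where open ≡-Reasoning

⟦⟧-⟦⟧≤⟦suc⟧-⟦⟧ : ∀ m n → ⟦ m ⟧ - ⟦ n ⟧ ≤ ⟦ suc m ⟧ - ⟦ n ⟧
⟦⟧-⟦⟧≤⟦suc⟧-⟦⟧ m n = begin
  ⟦ m ⟧ - ⟦ n ⟧         ≡⟨ +-identityˡ (⟦ m ⟧ - ⟦ n ⟧) ⟨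
  0ℚ + (⟦ m ⟧ - ⟦ n ⟧)  ≤⟨ +-monoˡ-≤ (⟦ m ⟧ - ⟦ n ⟧) (nonNegative⁻¹ 1ℚ) ⟩
  1ℚ + (⟦ m ⟧ - ⟦ n ⟧)  ≡⟨ 1+p-q≡1+[p-q] ⟦ m ⟧ ⟦ n ⟧ ⟨
  (1ℚ + ⟦ m ⟧) - ⟦ n ⟧  ≡⟨ cong (_- ⟦ n ⟧) (⟦suc⟧ m) ⟨
  ⟦ suc m ⟧ - ⟦ n ⟧     ∎
  where open ≤-Reasoning

module _ (M : MetricSpace) where
  open MetricSpace M

  d-telescope : ∀ {x y z} p q r → d x y ≤ p - q → d y z ≤ q - r → d x z ≤ p - r
  d-telescope {x} {y} {z} p q r dxy≤ dyz≤ = begin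
    d x z                ≤⟨ d-triangle x y z ⟩
    d x y + d y z        ≤⟨ +-mono-≤ dxy≤ dyz≤ ⟩
    (p - q) + (q - r)    ≡⟨ p-q+q-r≡p-r p q r ⟩
    p - r                ∎
    where open ≤-Reasoning

module QuadraticDecayInvariant (M : MetricSpace) {t : ℕ} (S : Fin t → MetricSpace.Carrier M) where
  open MetricSpace M
  open QuadraticDecay M S

  record Invariant (s : State) : Set where
    field
      subsumed-inactive    : ∀ i j → Subsumes s i j → j ∉ active s
      subsumers-comparable : ∀ i k j → Subsumes s i j → Subsumes s k j → i ≢ k →
                             Subsumes s i k ⊎ Subsumes s k i
      radius-bound         : ∀ i j → Subsumes s i j →
                             d (S i) (S j) ≤ ⟦ radius s i ⟧ - ⟦ radius s j ⟧
  open Invariant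

  Carried : State → Fin t → Fin t → Set
  Carried s k x = x ≡ k ⊎ Subsumes s k x

  carried⇔ : ∀ {s k x} → ⌊ x ≟ k ⌋ ∨ subs s k x ≡ true ⇔ Carried s k x
  carried⇔ {k = k} {x} = (⌊⌋≡true⇔ (x ≟ k) ⊎-⇔ ⇔-id _) ⇔-∘ ∨≡true⇔

  subsumer-of-carried : ∀ {s k i j} → Invariant s → k ∈ active s →
                        Subsumes s i j → Carried s k j → Carried s k i
  subsumer-of-carried inv k∈ i⊒k (inj₁ refl) = contradiction k∈ (subsumed-inactive inv _ _ i⊒k)
  subsumer-of-carried {k = k} {i} inv k∈ i⊒j (inj₂ k⊒j) with k ≟ i
  ... | yes refl = inj₁ refl
  ... | no k≢i with subsumers-comparable inv k i _ k⊒j i⊒j k≢i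
  ...   | inj₁ k⊒i = inj₂ k⊒i
  ...   | inj₂ i⊒k = contradiction k∈ (subsumed-inactive inv _ _ i⊒k)

  radius-advance : ∀ s k x →
    Carried s k x × radius (advance k s) x ≡ suc (radius s x) ⊎
    ¬ Carried s k x × radius (advance k s) x ≡ radius s x
  radius-advance s k x with ⌊ x ≟ k ⌋ ∨ subs s k x in moves
  ... | true  = inj₁ (to (carried⇔ {s}) moves , refl)
  ... | false = inj₂ ((λ c → case trans (sym moves) (from (carried⇔ {s}) c) of λ ()) , refl)

  advance-invariant : ∀ {s k} → Invariant s → k ∈ active s → Invariant (advance k s)
  advance-invariant {s} {k} inv k∈ = record
    { subsumed-inactive    = subsumed-inactive inv
    ; subsumers-comparable = subsumers-comparable inv
    ; radius-bound         = bound
    }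
    where
    bound : ∀ i j → Subsumes s i j →
            d (S i) (S j) ≤ ⟦ radius (advance k s) i ⟧ - ⟦ radius (advance k s) j ⟧
    bound i j i⊒j with radius-advance s k i | radius-advance s k j
    ... | inj₁ (_ , ri) | inj₁ (_ , rj) rewrite ri | rj =
      subst (d (S i) (S j) ≤_) (sym (⟦suc⟧-⟦suc⟧ (radius s i) (radius s j))) (radius-bound inv i j i⊒j)
    ... | inj₁ (_ , ri) | inj₂ (_ , rj) rewrite ri | rj =
      ≤-trans (radius-bound inv i j i⊒j) (⟦⟧-⟦⟧≤⟦suc⟧-⟦⟧ (radius s i) (radius s j))
    ... | inj₂ (_ , ri) | inj₂ (_ , rj) rewrite ri | rj = radius-bound inv i j i⊒j
    ... | inj₂ (i-stays , _) | inj₁ (j-carried , _) =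
      contradiction (subsumer-of-carried inv k∈ i⊒j j-carried) i-stays

  module _ {s : State} {t₂ k : Fin t} where
    subsumes-kill⇔ : ∀ {i j} → Subsumes (kill t₂ k s) i j ⇔ (Subsumes s i j ⊎ i ≡ t₂ × Carried s k j)
    subsumes-kill⇔ {i} = (⇔-id _ ⊎-⇔ ((⌊⌋≡true⇔ (i ≟ t₂) ×-⇔ carried⇔ {s}) ⇔-∘ ∧≡true⇔)) ⇔-∘ ∨≡true⇔

    kill-invariant : Invariant s → k ∈ active s → KillCond s k t₂ → Invariant (kill t₂ k s)
    kill-invariant inv k∈ killed = record
      { subsumed-inactive    = inactive
      ; subsumers-comparable = comparable
      ; radius-bound         = bound
      }
      where
      inactive : ∀ i j → Subsumes (kill t₂ k s) i j → j ∉ active (kill t₂ k s)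
      inactive i j i⊒j j∈ with ∈-filter⁻ (λ x → ¬? (x ≟ k)) j∈ | to subsumes-kill⇔ i⊒j
      ... | j∈s , _ | inj₁ i⊒ₛj           = subsumed-inactive inv i j i⊒ₛj j∈s
      ... | _ , j≢k | inj₂ (_ , inj₁ j≡k) = j≢k j≡k
      ... | j∈s , _ | inj₂ (_ , inj₂ k⊒j) = subsumed-inactive inv k j k⊒j j∈s

      inherits : ∀ {i j} → Subsumes s i j → Carried s k j → Subsumes (kill t₂ k s) t₂ i
      inherits i⊒j j-carried = from subsumes-kill⇔ (inj₂ (refl , subsumer-of-carried inv k∈ i⊒j j-carried))

      comparable : ∀ i i′ j → Subsumes (kill t₂ k s) i j → Subsumes (kill t₂ k s) i′ j → i ≢ i′ →
                   Subsumes (kill t₂ k s) i i′ ⊎ Subsumes (kill t₂ k s) i′ i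
      comparable i i′ j i⊒j i′⊒j i≢i′ with to subsumes-kill⇔ i⊒j | to subsumes-kill⇔ i′⊒j
      ... | inj₁ i⊒ₛj | inj₁ i′⊒ₛj =
        ⊎-map (from subsumes-kill⇔ ∘ inj₁) (from subsumes-kill⇔ ∘ inj₁)
              (subsumers-comparable inv i i′ j i⊒ₛj i′⊒ₛj i≢i′)
      ... | inj₂ (refl , j-carried) | inj₁ i′⊒ₛj = inj₁ (inherits i′⊒ₛj j-carried)
      ... | inj₁ i⊒ₛj | inj₂ (refl , j-carried) = inj₂ (inherits i⊒ₛj j-carried)
      ... | inj₂ (refl , _) | inj₂ (refl , _) = contradiction refl i≢i′

      t₂-near-k : d (S t₂) (S k) ≤ ⟦ radius s t₂ ⟧ - ⟦ radius s k ⟧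
      t₂-near-k = subst (_≤ _) (d-sym (S k) (S t₂)) killed

      bound : ∀ i j → Subsumes (kill t₂ k s) i j → d (S i) (S j) ≤ ⟦ radius s i ⟧ - ⟦ radius s j ⟧
      bound i j i⊒j with to subsumes-kill⇔ i⊒j
      ... | inj₁ i⊒ₛj               = radius-bound inv i j i⊒ₛj
      ... | inj₂ (refl , inj₁ refl) = t₂-near-k
      ... | inj₂ (refl , inj₂ k⊒j)  =
        d-telescope M ⟦ radius s t₂ ⟧ ⟦ radius s k ⟧ ⟦ radius s j ⟧ t₂-near-k (radius-bound inv k j k⊒j)

  initial-invariant : Invariant initial
  initial-invariant = record
    { subsumed-inactive    = λ _ _ ()
    ; subsumers-comparable = λ _ _ _ ()
    ; radius-bound         = λ _ _ ()
    }

  step-invariant : ∀ {s s′} → Step s s′ → Invariant s → Invariant s′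
  step-invariant (step-kill k t₂ k∈ _ killed) inv = kill-invariant (advance-invariant inv k∈) k∈ killed
  step-invariant (step-nokill k k∈ _)         inv = advance-invariant inv k∈

  reachable⇒invariant : ∀ {s} → Reachable s → Invariant s
  reachable⇒invariant start           = initial-invariant
  reachable⇒invariant (next reach st) = step-invariant st (reachable⇒invariant reach)

lemma5p11 : (M : MetricSpace) (t : ℕ) (S : Fin t → MetricSpace.Carrier M)
            (s : QuadraticDecay.State M S) → QuadraticDecay.Reachable M S s →
            (i j : Fin t) → QuadraticDecay.Subsumes M S s i j →
            MetricSpace.d M (S i) (S j)
              ≤ (⟦ QuadraticDecay.radius s i ⟧ - ⟦ QuadraticDecay.radius s j ⟧)
lemma5p11 M t S s reach = Invariant.radius-bound (reachable⇒invariant reach)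
  where open QuadraticDecayInvariant M S
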